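{- Let $G$ be a closed subgroup of $S_\infty$. For $a\in\omega$ let $G_a=\{g\in G:g(a)=a\}$, and for $n\in\omega$ let $G_{\langle n\rangle}=\{f\in G:\forall i<n\,(f(i)=i)\}$. Then for every ordinal $\alpha>0$ and all $a,n\in\omega$, $$\mathrm{rk}(G_a,G_{\langle n\rangle})\le\alpha\iff \exists m\ge n\ \forall b\in G_{\langle n\rangle}\cdot a\ \big(\mathrm{rk}(G_b,G_{\langle m\rangle})<\alpha\big).$$
   Context: $S_\infty$ is the group of permutations of $\omega$ with the pointwise convergence topology. For a topological group $G$, write $V\subseteq_1 G$ if $V$ is an open neighborhood of $1_G$. For $V,U\subseteq_1G$ define: $\mathrm{rk}(V,U)=0$ if $U\subseteq V$; for an ordinal $\beta>0$, $\mathrm{rk}(V,U)\le\beta$ if there is $W\subseteq_1 G$ with $\mathrm{rk}(V,gWg^{ -1})<\beta$ for all $g\in U$; $\mathrm{rk}(V,U)$ is the least such $\beta$, and $\infty$ if none exists. -}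

module Defs where

open import Level using (0ℓ)
open import Data.Nat using (ℕ; _<_)
open import Data.Product using (Σ; _×_; ∃)
open import Relation.Binary.PropositionalEquality using (_≡_)
open import Relation.Binary.Core using (Rel)

-- Elements of S_∞: bijections of ω, given with their inverse.
record Perm : Set where
  field
    fun  : ℕ → ℕ
    inv  : ℕ → ℕ
    invˡ : ∀ x → inv (fun x) ≡ x
    invʳ : ∀ x → fun (inv x) ≡ x
open Perm public

idₚ : Perm
idₚ = record { fun = λ x → x ; inv = λ x → x ; invˡ = λ _ → Relation.Binary.PropositionalEquality.refl ; invʳ = λ _ → Relation.Binary.PropositionalEquality.refl }

_∘ₚ_ : Perm → Perm → Perm
g ∘ₚ h = record
  { fun = λ x → fun g (fun h x)
  ; inv = λ x → inv h (inv g x)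
  ; invˡ = λ x → Relation.Binary.PropositionalEquality.trans
             (Relation.Binary.PropositionalEquality.cong (inv h) (invˡ g (fun h x))) (invˡ h x)
  ; invʳ = λ x → Relation.Binary.PropositionalEquality.trans
             (Relation.Binary.PropositionalEquality.cong (fun g) (invʳ h (inv g x))) (invʳ g x)
  }

_⁻¹ₚ : Perm → Perm
g ⁻¹ₚ = record { fun = inv g ; inv = fun g ; invˡ = invʳ g ; invʳ = invˡ g }

Subset : Set₁
Subset = Perm → Set

-- g and h agree on {0,…,n-1}: basic neighbourhoods of the pointwise convergence topology.
Agree : ℕ → Perm → Perm → Set
Agree n g h = ∀ i → i < n → fun g i ≡ fun h i

record ClosedSubgroup (G : Subset) : Set where
  field
    has-id   : G idₚ
    has-comp : ∀ g h → G g → G h → G (g ∘ₚ h)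
    has-inv  : ∀ g → G g → G (g ⁻¹ₚ)
    closed   : ∀ g → (∀ n → ∃ λ h → G h × Agree n g h) → G g

OpenIn : Subset → Subset → Set
OpenIn G V = (∀ g → V g → G g)
           × (∀ g → V g → ∃ λ n → ∀ h → G h → Agree n g h → V h)

OpenNbhd : Subset → Subset → Set
OpenNbhd G V = OpenIn G V × V idₚ

Conj : Subset → Perm → Subset → Subset
Conj G g W h = G h × W ((g ⁻¹ₚ) ∘ₚ (h ∘ₚ g))

-- rk(V,U) ≤ β, for β ranging over a well-order (A , _<_).
-- base : rk(V,U) = 0 ≤ β when U ⊆ V.
-- step : a witness W ⊆₁ G with rk(V, gWg⁻¹) < β for all g ∈ U.
data Rk≤ {A : Set} (_≺_ : Rel A 0ℓ) (G V : Subset) : Subset → A → Set₁ where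
  base : ∀ {U β} → (∀ g → U g → V g) → Rk≤ _≺_ G V U β
  step : ∀ {U β} (W : Subset) → OpenNbhd G W →
         (∀ g → U g → Σ A λ γ → γ ≺ β × Rk≤ _≺_ G V (Conj G g W) γ) →
         Rk≤ _≺_ G V U β

Rk< : {A : Set} (_≺_ : Rel A 0ℓ) (G V U : Subset) → A → Set₁
Rk< {A} _≺_ G V U β = Σ A λ γ → γ ≺ β × Rk≤ _≺_ G V U γ

Stab : Subset → ℕ → Subset
Stab G a g = G g × fun g a ≡ a

PtStab : Subset → ℕ → Subset
PtStab G n g = G g × (∀ i → i < n → fun g i ≡ i)

InOrbit : Subset → ℕ → ℕ → ℕ → Set
InOrbit G n a b = ∃ λ g → PtStab G n g × fun g a ≡ b

{-# OPTIONS --safe #-}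
-- Conjugation by h ∈ G preserves ranks, rk(hVh⁻¹, hUh⁻¹) ≤ rk(V, U): a witness W contains
-- some G_⟨k⟩, and if N bounds h({0,…,k-1}) then h⁻¹ G_⟨N⟩ h ⊆ G_⟨k⟩, so G_⟨N⟩ is a witness for
-- the conjugated pair.  Together with g G_a g⁻¹ = G_{g a} this gives both directions.  If W ⊇ G_⟨k⟩
-- witnesses rk(G_a, G_⟨n⟩) ≤ α, conjugating rk(G_a, g⁻¹ W g) < α by g ∈ G_⟨n⟩ gives
-- rk(G_{g a}, G_⟨max n k⟩) < α (in rank 0, G_⟨n⟩ fixes a and α > 0 suffices).  Conversely W = G_⟨m⟩
-- is a witness, by conjugating rk(G_{g⁻¹ a}, G_⟨m⟩) < α by g.
module Submission where

open import Defs
open import Level using (0ℓ)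
open import Data.Nat using (ℕ; zero; suc; _≤_; _<_; _⊔_; s≤s)
open import Data.Nat.Properties using (≤-refl; <-≤-trans; m≤m⊔n; m≤n⊔m; m≤n⇒m<n∨m≡n)
open import Data.Product using (_×_; ∃; _,_; proj₁; proj₂)
open import Data.Sum using (inj₁; inj₂)
open import Function using (id; _∘_)
open import Relation.Unary using (_⊆_)
open import Relation.Binary.PropositionalEquality
  using (_≡_; _≗_; refl; sym; trans; cong; subst; module ≡-Reasoning)
open import Relation.Binary.Core using (Rel)
open import Relation.Binary.Structures using (IsStrictTotalOrder)
open import Induction.WellFounded using (WellFounded)
open import Function.Bundles using (_⇔_; mk⇔)

bounded-image : (f : ℕ → ℕ) (k : ℕ) → ∃ λ N → ∀ i → i < k → f i < N
bounded-image f zero = 0 , λ _ ()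
bounded-image f (suc k) with bounded-image f k
... | N , f<N = N ⊔ suc (f k) , below
  where
  below : ∀ i → i < suc k → f i < N ⊔ suc (f k)
  below i (s≤s i≤k) with m≤n⇒m<n∨m≡n i≤k
  ... | inj₁ i<k  = <-≤-trans (f<N i i<k) (m≤m⊔n N _)
  ... | inj₂ refl = m≤n⊔m N _

infix 30 _^_

_^_ : Perm → Perm → Perm
x ^ h = (h ⁻¹ₚ) ∘ₚ (x ∘ₚ h)

^-^ : (x g h : Perm) → fun ((x ^ h) ^ (g ^ h)) ≗ fun ((x ^ g) ^ h)
^-^ x g h i = cong (inv h ∘ inv g) (begin
  fun h (inv h (fun x (fun h (inv h (fun g (fun h i)))))) ≡⟨ invʳ h _ ⟩
  fun x (fun h (inv h (fun g (fun h i))))                   ≡⟨ cong (fun x) (invʳ h _) ⟩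
  fun x (fun g (fun h i))                                   ∎)
  where open ≡-Reasoning

^-⁻¹ : (x g : Perm) → fun ((x ^ g) ^ (g ⁻¹ₚ)) ≗ fun x
^-⁻¹ x g i = trans (invʳ g _) (cong (fun x) (invʳ g i))

Fixes : ℕ → Perm → Set
Fixes n g = ∀ i → i < n → fun g i ≡ i

Fixes-mono : ∀ {m n g} → m ≤ n → Fixes n g → Fixes m g
Fixes-mono m≤n fix i i<m = fix i (<-≤-trans i<m m≤n)

Fixes-resp : ∀ {n g h} → fun g ≗ fun h → Fixes n g → Fixes n h
Fixes-resp g≗h fix i i<n = trans (sym (g≗h i)) (fix i i<n)

Fixes-⁻¹ : ∀ {n g} → Fixes n g → Fixes n (g ⁻¹ₚ)
Fixes-⁻¹ {g = g} fix i i<n = trans (cong (inv g) (sym (fix i i<n))) (invˡ g i)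

Fixes-^ : (h : Perm) (k : ℕ) → ∃ λ N → ∀ x → Fixes N x → Fixes k (x ^ h)
Fixes-^ h k with bounded-image (fun h) k
... | N , h<N = N , λ x fix i i<k → trans (cong (inv h) (fix (fun h i) (h<N i i<k))) (invˡ h i)

module _ {G : Subset} (G-subgroup : ClosedSubgroup G) where
  open ClosedSubgroup G-subgroup

  G-^ : ∀ {x h} → G x → G h → G (x ^ h)
  G-^ {x} {h} Gx Gh = has-comp _ _ (has-inv h Gh) (has-comp x h Gx Gh)

  PtStab-openNbhd : ∀ n → OpenNbhd G (PtStab G n)
  PtStab-openNbhd n = ((λ _ → proj₁) , isOpen) , has-id , λ _ _ → refl
    where
    isOpen : ∀ g → PtStab G n g → ∃ λ k → ∀ h → G h → Agree k g h → PtStab G n h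
    isOpen g (_ , fix) = n , λ h Gh g≈h → Gh , λ i i<n → trans (sym (g≈h i i<n)) (fix i i<n)

  openNbhd⇒PtStab⊆ : ∀ {W} → OpenNbhd G W → ∃ λ k → PtStab G k ⊆ W
  openNbhd⇒PtStab⊆ ((_ , isOpen) , W-id) with isOpen idₚ W-id
  ... | k , id≈⇒W = k , λ (Gh , fix) → id≈⇒W _ Gh (λ i i<k → sym (fix i i<k))

  Conj-Stab : ∀ {g a} → Conj G g (Stab G a) ⊆ Stab G (fun g a)
  Conj-Stab {g} (Gx , _ , x^g-fixes-a) = Gx , trans (sym (invʳ g _)) (cong (fun g) x^g-fixes-a)

  module _ {A : Set} {_≺_ : Rel A 0ℓ} where

    Rk≤-weaken : ∀ {V V′ U U′ β} → V ⊆ V′ → U′ ⊆ U →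
                 Rk≤ _≺_ G V U β → Rk≤ _≺_ G V′ U′ β
    Rk≤-weaken V⊆V′ U′⊆U (base U⊆V) = base λ _ → V⊆V′ ∘ U⊆V _ ∘ U′⊆U
    Rk≤-weaken {V′ = V′} {U′ = U′} {β} V⊆V′ U′⊆U (step W W-nbhd below) = step W W-nbhd below′
      where
      below′ : ∀ g → U′ g → Rk< _≺_ G V′ (Conj G g W) β
      below′ g g∈U′ with below g (U′⊆U g∈U′)
      ... | γ , γ≺β , rk = γ , γ≺β , Rk≤-weaken V⊆V′ id rk

    Rk≤-conj : ∀ {V U β} h → G h → Rk≤ _≺_ G V U β → Rk≤ _≺_ G (Conj G h V) (Conj G h U) β
    Rk≤-conj _ Gh (base U⊆V) = base λ _ (Gx , x^h∈U) → Gx , U⊆V _ x^h∈U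
    Rk≤-conj {V} {U} {β} h Gh (step W W-nbhd below) with openNbhd⇒PtStab⊆ W-nbhd
    ... | k , PtStab⊆W with Fixes-^ h k
    ... | N , conj-fixes = step (PtStab G N) (PtStab-openNbhd N) below′
      where
      below′ : ∀ g → Conj G h U g → Rk< _≺_ G (Conj G h V) (Conj G g (PtStab G N)) β
      below′ g (Gg , g^h∈U) with below (g ^ h) g^h∈U
      ... | γ , γ≺β , rk = γ , γ≺β , Rk≤-weaken id shrink (Rk≤-conj h Gh rk)
        where
        shrink : Conj G g (PtStab G N) ⊆ Conj G h (Conj G (g ^ h) W)
        shrink {x} (Gx , _ , x^g-fixes) = Gx , G-^ Gx Gh , PtStab⊆W (G-^ (G-^ Gx Gh) (G-^ Gg Gh) , fixes)
          where
          fixes : Fixes k ((x ^ h) ^ (g ^ h))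
          fixes = Fixes-resp {g = (x ^ g) ^ h} {h = (x ^ h) ^ (g ^ h)}
                             (sym ∘ ^-^ x g h) (conj-fixes (x ^ g) x^g-fixes)

    Rk≤-Stab-conj : ∀ {a U β} g → G g → Rk≤ _≺_ G (Stab G a) U β →
                    Rk≤ _≺_ G (Stab G (fun g a)) (Conj G g U) β
    Rk≤-Stab-conj g Gg = Rk≤-weaken (Conj-Stab {g}) id ∘ Rk≤-conj g Gg

    Rk≤⇒orbit-Rk< : ∀ {γ₀ α a n} → γ₀ ≺ α → Rk≤ _≺_ G (Stab G a) (PtStab G n) α →
                    ∃ λ m → n ≤ m × (∀ b → InOrbit G n a b → Rk< _≺_ G (Stab G b) (PtStab G m) α)
    Rk≤⇒orbit-Rk< {γ₀} {n = n} γ₀≺α (base PtStab⊆Stab) = n , ≤-refl , λ { _ (g , g∈ , refl) →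
      γ₀ , γ₀≺α , subst (λ b → Rk≤ _≺_ G (Stab G b) (PtStab G n) γ₀)
                        (sym (proj₂ (PtStab⊆Stab g g∈))) (base PtStab⊆Stab) }
    Rk≤⇒orbit-Rk< {α = α} {a} {n} _ (step W W-nbhd below) with openNbhd⇒PtStab⊆ W-nbhd
    ... | k , PtStab⊆W = n ⊔ k , m≤m⊔n n k , λ { _ (g , g∈ , refl) → at g g∈ }
      where
      at : ∀ g → PtStab G n g → Rk< _≺_ G (Stab G (fun g a)) (PtStab G (n ⊔ k)) α
      at g (Gg , g-fixes) with below (g ⁻¹ₚ) (has-inv g Gg , Fixes-⁻¹ {g = g} g-fixes)
      ... | γ , γ≺α , rk = γ , γ≺α , Rk≤-weaken id shrink (Rk≤-Stab-conj g Gg rk)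
        where
        shrink : PtStab G (n ⊔ k) ⊆ Conj G g (Conj G (g ⁻¹ₚ) W)
        shrink {x} (Gx , x-fixes) = Gx , G-^ Gx Gg , PtStab⊆W (G-^ (G-^ Gx Gg) (has-inv g Gg) , fixes)
          where
          fixes : Fixes k ((x ^ g) ^ (g ⁻¹ₚ))
          fixes = Fixes-resp {g = x} {h = (x ^ g) ^ (g ⁻¹ₚ)}
                             (sym ∘ ^-⁻¹ x g) (Fixes-mono {g = x} (m≤n⊔m n k) x-fixes)

    orbit-Rk<⇒Rk≤ : ∀ {α a n} m → (∀ b → InOrbit G n a b → Rk< _≺_ G (Stab G b) (PtStab G m) α) →
                    Rk≤ _≺_ G (Stab G a) (PtStab G n) α
    orbit-Rk<⇒Rk≤ {α} {a} {n} m orbit-rk< = step (PtStab G m) (PtStab-openNbhd m) below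
      where
      below : ∀ g → PtStab G n g → Rk< _≺_ G (Stab G a) (Conj G g (PtStab G m)) α
      below g (Gg , g-fixes) with orbit-rk< (inv g a) (g ⁻¹ₚ , (has-inv g Gg , Fixes-⁻¹ {g = g} g-fixes) , refl)
      ... | γ , γ≺α , rk = γ , γ≺α , subst (λ b → Rk≤ _≺_ G (Stab G b) (Conj G g (PtStab G m)) γ)
                                           (invʳ g a) (Rk≤-Stab-conj g Gg rk)

mainTheorem4 : (G : Subset) → ClosedSubgroup G →
               (A : Set) (_≺_ : Rel A 0ℓ) → IsStrictTotalOrder _≡_ _≺_ → WellFounded _≺_ →
               (α : A) → (∃ λ γ → γ ≺ α) → (a n : ℕ) →
               (Rk≤ _≺_ G (Stab G a) (PtStab G n) α
                 ⇔ (∃ λ m → n ≤ m × (∀ b → InOrbit G n a b → Rk< _≺_ G (Stab G b) (PtStab G m) α)))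
mainTheorem4 G G-subgroup A _≺_ _ _ α (_ , α>0) a n =
  mk⇔ (Rk≤⇒orbit-Rk< G-subgroup α>0) (λ (m , _ , orbit-rk<) → orbit-Rk<⇒Rk≤ G-subgroup m orbit-rk<)
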